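{- Let $\mathbb K$ be a field of characteristic zero, $\mathfrak d$ a delta operator on $\mathbb K[x]$, $\mathcal Z=(z_i)_{i\ge0}$ a sequence in $\mathbb K$, and $(t_n(x))_{n\ge0}$ the generalized Gončarov basis associated with $(\mathfrak d,\mathcal Z)$. Fix $j\in\mathbb N$ and define for each $n\in\mathbb N$ $$t_n^{(j)}(x):=\frac{1}{(n+j)_{(j)}}\,\mathfrak d^{j}\,t_{n+j}(x),$$ where $m_{(j)}=m(m-1)\cdots(m-j+1)$. Then $(t_n^{(j)}(x))_{n\ge0}$ is the generalized Gončarov basis associated with the pair $(\mathfrak d,\mathcal Z^{(j)})$. In particular, $\mathfrak d^{j}t_n(x)=n_{(j)}\,t^{(j)}_{n-j}(x)$.
   Context: For $a\in\mathbb K$, $E_a$ is the shift $f(x)\mapsto f(x+a)$. A linear operator on $\mathbb K[x]$ is shift-invariant if it commutes with all $E_a$. A delta operator is a shift-invariant linear operator $\mathfrak d$ with $\mathfrak d(x)$ a nonzero constant. $\varepsilon_z$ is evaluation at $z$, $\mathfrak d^i$ the $i$-th iterate. For a grid $\mathcal Z=(z_i)_{i\ge0}$, the shifted grid $\mathcal Z^{(j)}$ is the sequence whose $i$-th term is $z_{i+j}$. The generalized Gončarov basis associated with $(\mathfrak d,\mathcal Z)$ is the unique sequence of polynomials $(t_n)_{n\ge0}$ with $\deg t_n=n$ and $\varepsilon_{z_i}(\mathfrak d^i t_n)=n!\,\delta_{i,n}$ for all $i,n\in\mathbb N$. -}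

module Defs where

open import Level using (Level; _⊔_)
open import Algebra.Bundles using (CommutativeRing)
open import Data.Nat using (ℕ; zero; suc; _∸_; _<_; _!) renaming (_*_ to _*ℕ_)

open import Data.List using (List; []; _∷_; map)
open import Data.Product using (_×_; Σ)
open import Relation.Nullary using (¬_)

record Field (c ℓ : Level) : Set (Level.suc (c ⊔ ℓ)) where
  field
    commutativeRing : CommutativeRing c ℓ
  open CommutativeRing commutativeRing public
  field
    _⁻¹      : Carrier → Carrier
    inverseʳ : ∀ x → ¬ (x ≈ 0#) → (x * (x ⁻¹)) ≈ 1#
    0≉1      : ¬ (0# ≈ 1#)

fall : ℕ → ℕ → ℕ
fall m zero    = 1
fall m (suc j) = (m ∸ j) *ℕ fall m j


module PolyOver {c ℓ : Level} (F : Field c ℓ) where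
  open Field F

  fromℕ : ℕ → Carrier
  fromℕ zero    = 0#
  fromℕ (suc n) = 1# + fromℕ n

  CharZero : Set ℓ
  CharZero = ∀ n → ¬ (fromℕ (suc n) ≈ 0#)

  kdelta : ℕ → ℕ → Carrier
  kdelta zero    zero    = 1#
  kdelta zero    (suc _) = 0#
  kdelta (suc _) zero    = 0#
  kdelta (suc i) (suc n) = kdelta i n

  -- Polynomials in K[x] as coefficient lists (constant term first);
  -- equality is coefficientwise (trailing zeros irrelevant).
  Poly : Set c
  Poly = List Carrier

  coeff : Poly → ℕ → Carrier
  coeff []       _       = 0#
  coeff (a ∷ p)  zero    = a
  coeff (a ∷ p)  (suc n) = coeff p n

  _≈P_ : Poly → Poly → Set ℓ
  p ≈P q = ∀ n → coeff p n ≈ coeff q n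

  _+P_ : Poly → Poly → Poly
  []      +P q       = q
  (a ∷ p) +P []      = a ∷ p
  (a ∷ p) +P (b ∷ q) = (a + b) ∷ (p +P q)

  _·P_ : Carrier → Poly → Poly
  k ·P p = map (k *_) p

  X : Poly
  X = 0# ∷ 1# ∷ []

  const : Carrier → Poly
  const k = k ∷ []

  eval : Carrier → Poly → Carrier
  eval z []      = 0#
  eval z (a ∷ p) = a + z * eval z p

  -- shift operator E_a : f(x) ↦ f(x + a)
  shift : Carrier → Poly → Poly
  shift a []      = []
  shift a (c₀ ∷ p) = const c₀ +P ((0# ∷ q) +P (a ·P q))
    where q = shift a p

  HasDegree : Poly → ℕ → Set ℓ
  HasDegree p n = ¬ (coeff p n ≈ 0#) × (∀ m → n < m → coeff p m ≈ 0#)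

  record IsLinear (L : Poly → Poly) : Set (c ⊔ ℓ) where
    field
      cong-≈P : ∀ p q → p ≈P q → L p ≈P L q
      additive : ∀ p q → L (p +P q) ≈P (L p +P L q)
      homogeneous : ∀ k p → L (k ·P p) ≈P (k ·P L p)

  ShiftInvariant : (Poly → Poly) → Set (c ⊔ ℓ)
  ShiftInvariant L = ∀ a p → L (shift a p) ≈P shift a (L p)

  record IsDeltaOperator (d : Poly → Poly) : Set (c ⊔ ℓ) where
    field
      linear : IsLinear d
      shiftInvariant : ShiftInvariant d
      dx-const : Σ Carrier λ k → ¬ (k ≈ 0#) × (d X ≈P const k)

  iter : (Poly → Poly) → ℕ → Poly → Poly
  iter L zero    p = p
  iter L (suc i) p = L (iter L i p)

  shiftGrid : (ℕ → Carrier) → ℕ → ℕ → Carrier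
  shiftGrid z j i = z (i Data.Nat.+ j)

  record IsGoncarovBasis (d : Poly → Poly) (z : ℕ → Carrier) (t : ℕ → Poly) : Set ℓ where
    field
      degree : ∀ n → HasDegree (t n) n
      interp : ∀ i n → eval (z i) (iter d i (t n)) ≈ (fromℕ (n !) * kdelta i n)

  derivedBasis : (Poly → Poly) → (ℕ → Poly) → ℕ → ℕ → Poly
  derivedBasis d t j n = (fromℕ (fall (n Data.Nat.+ j) j) ⁻¹) ·P iter d j (t (n Data.Nat.+ j))

-- Shift invariance expresses 𝔡 xᵐ through the constants γᵢ = (𝔡 xⁱ)(0), and since a
-- polynomial over a field of characteristic zero is determined by its values at 0, 1, 2, …,
-- this shows that 𝔡 lowers the degree by exactly one, multiplying the leading coefficient
-- of a polynomial of degree N by N k, where 𝔡 x = k.  Hence 𝔡ʲ t_{n+j} has degree n, and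
-- the interpolation conditions of t⁽ʲ⁾ for the grid 𝒵⁽ʲ⁾ are those of t for 𝒵 with all
-- indices shifted by j, rescaled by (n+j)! = (n+j)_(j) n!.  For n < j both sides of
-- 𝔡ʲ tₙ = n_(j) t⁽ʲ⁾_{n−j} vanish.
module Submission where

open import Defs
open import Level using (Level)
open import Algebra.Bundles using (Semiring)
open import Function using (_∘_)
open import Data.Nat as ℕ using (ℕ; zero; suc; _≤_; _<_; z≤n; s≤s; _∸_; _!)
import Data.Nat.Properties as ℕₚ
open import Data.Nat.Combinatorics using (_C_; nC1≡n; k>n⇒nCk≡0; nCk+nC[k+1]≡[n+1]C[k+1])
open import Data.List using ([]; _∷_; length; drop)
open import Data.Product using (_×_; _,_; proj₁; proj₂)
open import Data.Sum using (inj₁; inj₂)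
open import Relation.Binary.PropositionalEquality as ≡ using (_≡_; _≢_)

fall-*-! : ∀ m j → j ≤ m → fall m j ℕ.* (m ∸ j) ! ≡ m !
fall-*-! m zero    _   = ℕₚ.*-identityˡ (m !)
fall-*-! m (suc j) j<m = begin
  (m ∸ j) ℕ.* fall m j ℕ.* r !  ≡⟨ ≡.cong (λ e → e ℕ.* fall m j ℕ.* r !) m∸j≡1+r ⟩
  suc r ℕ.* fall m j ℕ.* r !    ≡⟨ ≡.cong (ℕ._* r !) (ℕₚ.*-comm (suc r) (fall m j)) ⟩
  fall m j ℕ.* suc r ℕ.* r !    ≡⟨ ℕₚ.*-assoc (fall m j) (suc r) (r !) ⟩
  fall m j ℕ.* (suc r) !        ≡⟨ ≡.cong (λ e → fall m j ℕ.* e !) m∸j≡1+r ⟨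
  fall m j ℕ.* (m ∸ j) !        ≡⟨ fall-*-! m j (ℕₚ.<⇒≤ j<m) ⟩
  m !                           ∎
  where
    open ≡.≡-Reasoning
    r = m ∸ suc j
    m∸j≡1+r : m ∸ j ≡ suc r
    m∸j≡1+r = ℕₚ.+-∸-assoc 1 j<m

fall≢0 : ∀ {m j} → j ≤ m → fall m j ≢ 0
fall≢0 {m} {j} j≤m fall≡0 = ℕₚ.<⇒≢ (ℕₚ.1≤n! m) (begin
  0                       ≡⟨ ≡.cong (ℕ._* (m ∸ j) !) fall≡0 ⟨
  fall m j ℕ.* (m ∸ j) !  ≡⟨ fall-*-! m j j≤m ⟩
  m !                     ∎)
  where open ≡.≡-Reasoning

fall≡0 : ∀ {m j} → m < j → fall m j ≡ 0
fall≡0 {m} {suc j} (s≤s m≤j) with ℕₚ.m≤n⇒m<n∨m≡n m≤j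
... | inj₁ m<j    = ≡.trans (≡.cong ((m ∸ j) ℕ.*_) (fall≡0 m<j)) (ℕₚ.*-zeroʳ (m ∸ j))
... | inj₂ ≡.refl = ≡.cong (ℕ._* fall m m) (ℕₚ.n∸n≡0 m)

module FieldProperties {c ℓ : Level} (F : Field c ℓ) where
  open Field F
  open PolyOver F using (fromℕ; CharZero)
  open import Algebra.Properties.Group +-group public
    using (x≈z//y; //-rightDividesˡ) renaming (∙-cancelˡ to +-cancelˡ)
  open import Algebra.Definitions.RawSemiring (Semiring.rawSemiring semiring) public using (_^_)
  open import Algebra.Solver.Ring.NaturalCoefficients.Default commutativeSemiring
  open import Relation.Binary.Reasoning.Setoid setoid

  *-cancelˡ : ∀ {u v w} → u ≉ 0# → u * v ≈ u * w → v ≈ w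
  *-cancelˡ {u} {v} {w} u≉0 uv≈uw = begin
    v                    ≈⟨ *-identityˡ v ⟨
    1# * v               ≈⟨ *-congʳ (trans (*-comm _ _) (inverseʳ u u≉0)) ⟨
    (u ⁻¹ * u) * v       ≈⟨ *-assoc (u ⁻¹) u v ⟩
    u ⁻¹ * (u * v)       ≈⟨ *-congˡ uv≈uw ⟩
    u ⁻¹ * (u * w)       ≈⟨ *-assoc (u ⁻¹) u w ⟨
    (u ⁻¹ * u) * w       ≈⟨ *-congʳ (trans (*-comm _ _) (inverseʳ u u≉0)) ⟩
    1# * w               ≈⟨ *-identityˡ w ⟩
    w                    ∎

  *-≉0 : ∀ {u v} → u ≉ 0# → v ≉ 0# → u * v ≉ 0#
  *-≉0 {u} u≉0 v≉0 uv≈0 = v≉0 (*-cancelˡ u≉0 (trans uv≈0 (sym (zeroʳ u))))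

  ⁻¹-≉0 : ∀ {u} → u ≉ 0# → u ⁻¹ ≉ 0#
  ⁻¹-≉0 {u} u≉0 u⁻¹≈0 = 0≉1 (begin
    0#          ≈⟨ zeroʳ u ⟨
    u * 0#      ≈⟨ *-congˡ u⁻¹≈0 ⟨
    u * u ⁻¹    ≈⟨ inverseʳ u u≉0 ⟩
    1#          ∎)

  ^-≉0 : ∀ {u} → u ≉ 0# → ∀ j → u ^ j ≉ 0#
  ^-≉0 u≉0 zero    = 0≉1 ∘ sym
  ^-≉0 u≉0 (suc j) = *-≉0 u≉0 (^-≉0 u≉0 j)

  fromℕ-+ : ∀ m n → fromℕ (m ℕ.+ n) ≈ fromℕ m + fromℕ n
  fromℕ-+ zero    n = sym (+-identityˡ _)
  fromℕ-+ (suc m) n = trans (+-congˡ (fromℕ-+ m n)) (sym (+-assoc _ _ _))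

  fromℕ-* : ∀ m n → fromℕ (m ℕ.* n) ≈ fromℕ m * fromℕ n
  fromℕ-* zero    n = sym (zeroˡ _)
  fromℕ-* (suc m) n = begin
    fromℕ (n ℕ.+ m ℕ.* n)         ≈⟨ fromℕ-+ n (m ℕ.* n) ⟩
    fromℕ n + fromℕ (m ℕ.* n)     ≈⟨ +-congˡ (fromℕ-* m n) ⟩
    fromℕ n + fromℕ m * fromℕ n   ≈⟨ solve 2 (λ a b → b :+ a :* b := (con 1 :+ a) :* b) refl (fromℕ m) (fromℕ n) ⟩
    (1# + fromℕ m) * fromℕ n      ∎

  fromℕ-≉0 : CharZero → ∀ {n} → n ≢ 0 → fromℕ n ≉ 0#
  fromℕ-≉0 _     {zero}  n≢0 = λ _ → n≢0 ≡.refl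
  fromℕ-≉0 char0 {suc n} _   = char0 n

module PolyProperties {c ℓ : Level} (F : Field c ℓ) where
  open Field F
  open PolyOver F
  open FieldProperties F
  open import Algebra.Properties.CommutativeSemigroup *-commutativeSemigroup using (x∙yz≈y∙xz)
  open import Algebra.Solver.Ring.NaturalCoefficients.Default commutativeSemiring
  open import Relation.Binary.Reasoning.Setoid setoid

  DegreeAtMost : Poly → ℕ → Set ℓ
  DegreeAtMost p N = ∀ i → N < i → coeff p i ≈ 0#

  coeff-+P : ∀ p q i → coeff (p +P q) i ≈ coeff p i + coeff q i
  coeff-+P []      q       i       = sym (+-identityˡ _)
  coeff-+P (a ∷ p) []      i       = sym (+-identityʳ _)
  coeff-+P (a ∷ p) (b ∷ q) zero    = refl
  coeff-+P (a ∷ p) (b ∷ q) (suc i) = coeff-+P p q i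

  coeff-·P : ∀ u p i → coeff (u ·P p) i ≈ u * coeff p i
  coeff-·P u []      i       = sym (zeroʳ u)
  coeff-·P u (a ∷ p) zero    = refl
  coeff-·P u (a ∷ p) (suc i) = coeff-·P u p i

  ·P-inverse : ∀ {u} → u ≉ 0# → ∀ p → p ≈P (u ·P ((u ⁻¹) ·P p))
  ·P-inverse {u} u≉0 p i = begin
    coeff p i                     ≈⟨ *-identityˡ _ ⟨
    1# * coeff p i                ≈⟨ *-congʳ (inverseʳ u u≉0) ⟨
    (u * u ⁻¹) * coeff p i        ≈⟨ *-assoc _ _ _ ⟩
    u * (u ⁻¹ * coeff p i)        ≈⟨ *-congˡ (coeff-·P (u ⁻¹) p i) ⟨
    u * coeff ((u ⁻¹) ·P p) i     ≈⟨ coeff-·P u ((u ⁻¹) ·P p) i ⟨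
    coeff (u ·P ((u ⁻¹) ·P p)) i  ∎

  eval-·P : ∀ w u p → eval w (u ·P p) ≈ u * eval w p
  eval-·P w u []      = sym (zeroʳ u)
  eval-·P w u (a ∷ p) = begin
    u * a + w * eval w (u ·P p)  ≈⟨ +-congˡ (*-congˡ (eval-·P w u p)) ⟩
    u * a + w * (u * eval w p)   ≈⟨ solve 4 (λ u a w e → u :* a :+ w :* (u :* e) := u :* (a :+ w :* e)) refl u a w (eval w p) ⟩
    u * (a + w * eval w p)       ∎

  eval-≈[] : ∀ w p → p ≈P [] → eval w p ≈ 0#
  eval-≈[] w []      _    = refl
  eval-≈[] w (a ∷ p) p≈[] = begin
    a + w * eval w p  ≈⟨ +-cong (p≈[] 0) (*-congˡ (eval-≈[] w p (p≈[] ∘ suc))) ⟩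
    0# + w * 0#       ≈⟨ +-identityˡ _ ⟩
    w * 0#            ≈⟨ zeroʳ w ⟩
    0#                ∎

  eval-cong : ∀ w p q → p ≈P q → eval w p ≈ eval w q
  eval-cong w []      q       p≈q = sym (eval-≈[] w q (sym ∘ p≈q))
  eval-cong w (a ∷ p) []      p≈q = eval-≈[] w (a ∷ p) p≈q
  eval-cong w (a ∷ p) (b ∷ q) p≈q = +-cong (p≈q 0) (*-congˡ (eval-cong w p q (p≈q ∘ suc)))

  iter-+ : ∀ L i j p → iter L i (iter L j p) ≡ iter L (i ℕ.+ j) p
  iter-+ L zero    j p = ≡.refl
  iter-+ L (suc i) j p = ≡.cong L (iter-+ L i j p)

  kdelta-+ : ∀ i n j → kdelta (i ℕ.+ j) (n ℕ.+ j) ≡ kdelta i n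
  kdelta-+ i n zero    rewrite ℕₚ.+-identityʳ i | ℕₚ.+-identityʳ n = ≡.refl
  kdelta-+ i n (suc j) rewrite ℕₚ.+-suc i j | ℕₚ.+-suc n j = kdelta-+ i n j

  coeff-shift-∷ : ∀ a b p i →
    coeff (shift a (b ∷ p)) i ≈ coeff (const b) i + (coeff (0# ∷ shift a p) i + a * coeff (shift a p) i)
  coeff-shift-∷ a b p i = begin
    coeff (const b +P (q′ +P (a ·P q))) i                 ≈⟨ coeff-+P (const b) (q′ +P (a ·P q)) i ⟩
    coeff (const b) i + coeff (q′ +P (a ·P q)) i          ≈⟨ +-congˡ (coeff-+P q′ (a ·P q) i) ⟩
    coeff (const b) i + (coeff q′ i + coeff (a ·P q) i)   ≈⟨ +-congˡ (+-congˡ (coeff-·P a q i)) ⟩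
    coeff (const b) i + (coeff q′ i + a * coeff q i)      ∎
    where
      q = shift a p
      q′ = 0# ∷ q

  coeff₀-shift : ∀ a p → coeff (shift a p) 0 ≈ eval a p
  coeff₀-shift a []      = refl
  coeff₀-shift a (b ∷ p) = begin
    coeff (shift a (b ∷ p)) 0               ≈⟨ coeff-shift-∷ a b p 0 ⟩
    b + (0# + a * coeff (shift a p) 0)      ≈⟨ +-congˡ (+-identityˡ _) ⟩
    b + a * coeff (shift a p) 0             ≈⟨ +-congˡ (*-congˡ (coeff₀-shift a p)) ⟩
    b + a * eval a p                        ∎

  length-∷+P·P : ∀ u b q → length ((b ∷ q) +P (u ·P q)) ≡ suc (length q)
  length-∷+P·P u b []      = ≡.refl
  length-∷+P·P u b (x ∷ q) = ≡.cong suc (length-∷+P·P u x q)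

  length-shift : ∀ a p → length (shift a p) ≡ length p
  length-shift a []      = ≡.refl
  length-shift a (b ∷ p) with shift a p | length-shift a p
  ... | []    | eq = ≡.cong suc eq
  ... | x ∷ q | eq = ≡.cong suc (≡.trans (length-∷+P·P a x q) eq)

  infixr 30 X^_⋆_
  infix 40 X^_

  X^_⋆_ : ℕ → Poly → Poly
  X^ zero  ⋆ p = p
  X^ suc j ⋆ p = 0# ∷ X^ j ⋆ p

  X^_ : ℕ → Poly
  X^ j = X^ j ⋆ const 1#

  length-X^⋆ : ∀ j p → length (X^ j ⋆ p) ≡ j ℕ.+ length p
  length-X^⋆ zero    p = ≡.refl
  length-X^⋆ (suc j) p = ≡.cong suc (length-X^⋆ j p)

  X^⋆-∷ : ∀ j b p → X^ j ⋆ (b ∷ p) ≈P ((b ·P X^ j) +P X^ suc j ⋆ p)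
  X^⋆-∷ zero    b p zero    = sym (trans (+-identityʳ _) (*-identityʳ b))
  X^⋆-∷ zero    b p (suc i) = refl
  X^⋆-∷ (suc j) b p zero    = sym (trans (+-identityʳ _) (zeroʳ b))
  X^⋆-∷ (suc j) b p (suc i) = X^⋆-∷ j b p i

  X^⋆-≈[] : ∀ j {p} → p ≈P [] → X^ j ⋆ p ≈P []
  X^⋆-≈[] zero    p≈[] = p≈[]
  X^⋆-≈[] (suc j) p≈[] zero    = refl
  X^⋆-≈[] (suc j) p≈[] (suc i) = X^⋆-≈[] j p≈[] i

  sumTo : ℕ → (ℕ → Carrier) → Carrier
  sumTo zero    f = 0#
  sumTo (suc n) f = f 0 + sumTo n (f ∘ suc)

  sumTo-cong : ∀ n {f g} → (∀ i → i < n → f i ≈ g i) → sumTo n f ≈ sumTo n g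
  sumTo-cong zero    _   = refl
  sumTo-cong (suc n) f≈g = +-cong (f≈g 0 (s≤s z≤n)) (sumTo-cong n (λ i i<n → f≈g (suc i) (s≤s i<n)))

  *-distribˡ-sumTo : ∀ u n f → u * sumTo n f ≈ sumTo n (λ i → u * f i)
  *-distribˡ-sumTo u zero    f = zeroʳ u
  *-distribˡ-sumTo u (suc n) f = trans (distribˡ u _ _) (+-congˡ (*-distribˡ-sumTo u n (f ∘ suc)))

  sumTo-reverse : ∀ m f → sumTo (suc m) f ≈ sumTo (suc m) (λ i → f (m ∸ i))
  sumTo-reverse zero    f = refl
  sumTo-reverse (suc m) f = begin
    sumTo (suc (suc m)) f                           ≈⟨ sumTo-last (suc m) f ⟩
    sumTo (suc m) f + f (suc m)                     ≈⟨ +-congʳ (sumTo-reverse m f) ⟩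
    sumTo (suc m) (λ i → f (m ∸ i)) + f (suc m)     ≈⟨ +-comm _ _ ⟩
    f (suc m) + sumTo (suc m) (λ i → f (m ∸ i))     ∎
    where
      sumTo-last : ∀ n f → sumTo (suc n) f ≈ sumTo n f + f n
      sumTo-last zero    f = trans (+-identityʳ _) (sym (+-identityˡ _))
      sumTo-last (suc n) f = trans (+-congˡ (sumTo-last n (f ∘ suc))) (sym (+-assoc _ _ _))

  fromCoeffs : ℕ → (ℕ → Carrier) → Poly
  fromCoeffs zero    q = []
  fromCoeffs (suc n) q = q 0 ∷ fromCoeffs n (q ∘ suc)

  eval-fromCoeffs : ∀ a n q → eval a (fromCoeffs n q) ≈ sumTo n (λ i → q i * a ^ i)
  eval-fromCoeffs a zero    q = refl
  eval-fromCoeffs a (suc n) q = +-cong (sym (*-identityʳ _)) (begin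
    a * eval a (fromCoeffs n (q ∘ suc))          ≈⟨ *-congˡ (eval-fromCoeffs a n (q ∘ suc)) ⟩
    a * sumTo n (λ i → q (suc i) * a ^ i)        ≈⟨ *-distribˡ-sumTo a n _ ⟩
    sumTo n (λ i → a * (q (suc i) * a ^ i))      ≈⟨ sumTo-cong n (λ i _ → x∙yz≈y∙xz a (q (suc i)) (a ^ i)) ⟩
    sumTo n (λ i → q (suc i) * (a * a ^ i))      ∎)

  coeff-fromCoeffs-< : ∀ n q {i} → i < n → coeff (fromCoeffs n q) i ≡ q i
  coeff-fromCoeffs-< (suc n) q {zero}  _         = ≡.refl
  coeff-fromCoeffs-< (suc n) q {suc i} (s≤s i<n) = coeff-fromCoeffs-< n (q ∘ suc) i<n

  coeff-fromCoeffs-≥ : ∀ n q {i} → n ≤ i → coeff (fromCoeffs n q) i ≡ 0#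
  coeff-fromCoeffs-≥ zero    q         _         = ≡.refl
  coeff-fromCoeffs-≥ (suc n) q {suc i} (s≤s n≤i) = coeff-fromCoeffs-≥ n (q ∘ suc) n≤i

  coeff-shift-X^ : ∀ a m i → coeff (shift a (X^ m)) i ≈ fromℕ (m C i) * a ^ (m ∸ i)
  coeff-shift-X^ a zero    zero    = sym (*-identityʳ _)
  coeff-shift-X^ a zero    (suc i) = sym (zeroˡ _)
  coeff-shift-X^ a (suc m) zero    = begin
    coeff (shift a (X^ suc m)) 0                 ≈⟨ coeff-shift-∷ a 0# (X^ m) 0 ⟩
    0# + (0# + a * coeff (shift a (X^ m)) 0)     ≈⟨ +-congˡ (+-congˡ (*-congˡ (coeff-shift-X^ a m 0))) ⟩
    0# + (0# + a * (fromℕ 1 * a ^ m))            ≈⟨ solve 2 (λ a y → con 0 :+ (con 0 :+ a :* ((con 1 :+ con 0) :* y)) := (con 1 :+ con 0) :* (a :* y)) refl a (a ^ m) ⟩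
    fromℕ 1 * a ^ suc m                          ∎
  coeff-shift-X^ a (suc m) (suc i) = begin
    coeff (shift a (X^ suc m)) (suc i)                                        ≈⟨ coeff-shift-∷ a 0# (X^ m) (suc i) ⟩
    0# + (coeff q i + a * coeff q (suc i))                                     ≈⟨ +-identityˡ _ ⟩
    coeff q i + a * coeff q (suc i)                                            ≈⟨ +-cong (coeff-shift-X^ a m i) (*-congˡ (coeff-shift-X^ a m (suc i))) ⟩
    fromℕ (m C i) * a ^ (m ∸ i) + a * (fromℕ (m C suc i) * a ^ (m ∸ suc i))    ≈⟨ +-congˡ a-absorbed ⟩
    fromℕ (m C i) * a ^ (m ∸ i) + fromℕ (m C suc i) * a ^ (m ∸ i)             ≈⟨ distribʳ _ _ _ ⟨
    (fromℕ (m C i) + fromℕ (m C suc i)) * a ^ (m ∸ i)                         ≈⟨ *-congʳ (fromℕ-+ (m C i) (m C suc i)) ⟨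
    fromℕ (m C i ℕ.+ m C suc i) * a ^ (m ∸ i)                                 ≡⟨ ≡.cong (λ n → fromℕ n * a ^ (m ∸ i)) (nCk+nC[k+1]≡[n+1]C[k+1] m i) ⟩
    fromℕ (suc m C suc i) * a ^ (m ∸ i)                                       ∎
    where
      q = shift a (X^ m)
      -- when m ≤ i the truncated exponent m ∸ suc i is junk, but then m C suc i = 0
      a-absorbed : a * (fromℕ (m C suc i) * a ^ (m ∸ suc i)) ≈ fromℕ (m C suc i) * a ^ (m ∸ i)
      a-absorbed with ℕₚ.<-≤-connex i m
      ... | inj₁ i<m = trans (x∙yz≈y∙xz a _ _)
                             (reflexive (≡.cong (λ e → fromℕ (m C suc i) * a ^ e) (≡.sym (ℕₚ.+-∸-assoc 1 i<m))))
      ... | inj₂ m≤i rewrite k>n⇒nCk≡0 (s≤s m≤i) = trans (*-congˡ (zeroˡ _)) (trans (zeroʳ a) (sym (zeroˡ _)))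

module PolyIdentityPrinciple {c ℓ : Level} (F : Field c ℓ) where
  open Field F
  open PolyOver F
  open FieldProperties F
  open import Algebra.Solver.Ring.NaturalCoefficients.Default commutativeSemiring
  open import Relation.Binary.Reasoning.Setoid setoid

  tailValues : Carrier → Poly → Poly
  tailValues r []      = []
  tailValues r (b ∷ q) = eval r (b ∷ q) ∷ tailValues r q

  quotient : Carrier → Poly → Poly
  quotient r []      = []
  quotient r (a ∷ p) = tailValues r p

  length-tailValues : ∀ r p → length (tailValues r p) ≡ length p
  length-tailValues r []      = ≡.refl
  length-tailValues r (b ∷ q) = ≡.cong suc (length-tailValues r q)

  coeff-tailValues : ∀ r p i → coeff (tailValues r p) i ≡ eval r (drop i p)
  coeff-tailValues r []      zero    = ≡.refl
  coeff-tailValues r []      (suc i) = ≡.refl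
  coeff-tailValues r (b ∷ q) zero    = ≡.refl
  coeff-tailValues r (b ∷ q) (suc i) = coeff-tailValues r q i

  coeff-quotient : ∀ r p i → coeff (quotient r p) i ≡ eval r (drop (suc i) p)
  coeff-quotient r []      i = ≡.refl
  coeff-quotient r (a ∷ p) i = coeff-tailValues r p i

  eval-quotient : ∀ x r p → eval x p ≈ eval r p + (x - r) * eval x (quotient r p)
  eval-quotient x r []      = sym (trans (+-identityˡ _) (zeroʳ _))
  eval-quotient x r (a ∷ p) = eval-∷ a p
    where
      x≈[x-r]+r : x ≈ (x - r) + r
      x≈[x-r]+r = sym (//-rightDividesˡ r x)

      horner-step : ∀ a B H → a + x * (B + (x - r) * H) ≈ (a + r * B) + (x - r) * (B + x * H)
      horner-step a B H = begin
        a + x * (B + (x - r) * H)                          ≈⟨ +-congˡ (*-congʳ x≈[x-r]+r) ⟩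
        a + ((x - r) + r) * (B + (x - r) * H)              ≈⟨ solve 5 (λ a r u B H → a :+ (u :+ r) :* (B :+ u :* H) := (a :+ r :* B) :+ u :* (B :+ (u :+ r) :* H)) refl a r (x - r) B H ⟩
        (a + r * B) + (x - r) * (B + ((x - r) + r) * H)    ≈⟨ +-congˡ (*-congˡ (+-congˡ (*-congʳ x≈[x-r]+r))) ⟨
        (a + r * B) + (x - r) * (B + x * H)                ∎

      eval-∷ : ∀ a p → eval x (a ∷ p) ≈ eval r (a ∷ p) + (x - r) * eval x (tailValues r p)
      eval-∷ a []      = solve 4 (λ a x r u → a :+ x :* con 0 := (a :+ r :* con 0) :+ u :* con 0) refl a x r (x - r)
      eval-∷ a (b ∷ q) = trans (+-congˡ (*-congˡ (eval-∷ b q))) (horner-step a (eval r (b ∷ q)) (eval x (tailValues r q)))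

  eval-drop : ∀ r p i → coeff p i + r * eval r (drop (suc i) p) ≈ eval r (drop i p)
  eval-drop r []      zero    = trans (+-identityˡ _) (zeroʳ r)
  eval-drop r []      (suc i) = trans (+-identityˡ _) (zeroʳ r)
  eval-drop r (a ∷ p) zero    = refl
  eval-drop r (a ∷ p) (suc i) = eval-drop r p i

  ≈P-from-eval-drop : ∀ r p q → (∀ i → eval r (drop i p) ≈ eval r (drop i q)) → p ≈P q
  ≈P-from-eval-drop r p q p≈q i = begin
    coeff p i                                            ≈⟨ x≈z//y _ _ _ (eval-drop r p i) ⟩
    eval r (drop i p) - r * eval r (drop (suc i) p)      ≈⟨ +-cong (p≈q i) (-‿cong (*-congˡ (p≈q (suc i)))) ⟩
    eval r (drop i q) - r * eval r (drop (suc i) q)      ≈⟨ x≈z//y _ _ _ (eval-drop r q i) ⟨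
    coeff q i                                            ∎

  module _ (char0 : CharZero) where

    -- Dividing by x − s, the quotients agree at s+1, s+2, …, where x − s is a nonzero natural.
    eval-injective-from : ∀ n s p q → length p ≤ n → length q ≤ n →
                          (∀ m → eval (fromℕ (m ℕ.+ s)) p ≈ eval (fromℕ (m ℕ.+ s)) q) → p ≈P q
    eval-injective-from zero    s [] [] _ _ _ = λ _ → refl
    eval-injective-from (suc n) s p q |p|≤1+n |q|≤1+n p≈q = ≈P-from-eval-drop r p q tails-agree
      where
        r = fromℕ s

        length-quotient : ∀ p → length p ≤ suc n → length (quotient r p) ≤ n
        length-quotient []      _         = z≤n
        length-quotient (a ∷ p) (s≤s |p|≤n) = ≡.subst (_≤ n) (≡.sym (length-tailValues r p)) |p|≤n

        quotients-agree : ∀ m → eval (fromℕ (m ℕ.+ suc s)) (quotient r p) ≈ eval (fromℕ (m ℕ.+ suc s)) (quotient r q)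
        quotients-agree m = *-cancelˡ x-r≉0 (+-cancelˡ (eval r p) _ _ (begin
          eval r p + (x - r) * eval x (quotient r p)    ≈⟨ eval-quotient x r p ⟨
          eval x p                                      ≈⟨ p≈q′ ⟩
          eval x q                                      ≈⟨ eval-quotient x r q ⟩
          eval r q + (x - r) * eval x (quotient r q)    ≈⟨ +-congʳ (p≈q 0) ⟨
          eval r p + (x - r) * eval x (quotient r q)    ∎))
          where
            x = fromℕ (m ℕ.+ suc s)
            m+1+s≡1+m+s : m ℕ.+ suc s ≡ suc m ℕ.+ s
            m+1+s≡1+m+s = ℕₚ.+-suc m s
            p≈q′ : eval x p ≈ eval x q
            p≈q′ rewrite m+1+s≡1+m+s = p≈q (suc m)
            x-r≉0 : x - r ≉ 0#
            x-r≉0 x-r≈0 = char0 m (trans (x≈z//y _ _ _ (sym (trans (reflexive (≡.cong fromℕ m+1+s≡1+m+s)) (fromℕ-+ (suc m) s)))) x-r≈0)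

        tails-agree : ∀ i → eval r (drop i p) ≈ eval r (drop i q)
        tails-agree zero    = p≈q 0
        tails-agree (suc i) = begin
          eval r (drop (suc i) p)   ≡⟨ coeff-quotient r p i ⟨
          coeff (quotient r p) i    ≈⟨ eval-injective-from n (suc s) (quotient r p) (quotient r q)
                                         (length-quotient p |p|≤1+n) (length-quotient q |q|≤1+n) quotients-agree i ⟩
          coeff (quotient r q) i    ≡⟨ coeff-quotient r q i ⟩
          eval r (drop (suc i) q)   ∎

    eval-injective : ∀ p q → (∀ a → eval a p ≈ eval a q) → p ≈P q
    eval-injective p q p≈q = eval-injective-from (length p ℕ.+ length q) 0 p q (ℕₚ.m≤m+n _ _) (ℕₚ.m≤n+m _ _) (λ _ → p≈q _)

module DeltaOperatorProperties {c ℓ : Level} (F : Field c ℓ) (char0 : PolyOver.CharZero F)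
  (d : PolyOver.Poly F → PolyOver.Poly F) (δ : PolyOver.IsDeltaOperator F d) where
  open Field F
  open PolyOver F
  open FieldProperties F
  open PolyProperties F
  open PolyIdentityPrinciple F using (eval-injective)
  open IsDeltaOperator δ
  open IsLinear linear
  open import Algebra.Solver.Ring.NaturalCoefficients.Default commutativeSemiring
  open import Relation.Binary.Reasoning.Setoid setoid

  k : Carrier
  k = proj₁ dx-const

  k≉0 : k ≉ 0#
  k≉0 = proj₁ (proj₂ dx-const)

  dX≈k : d X ≈P const k
  dX≈k = proj₂ (proj₂ dx-const)

  d-≈[] : ∀ {q} → q ≈P [] → d q ≈P []
  d-≈[] {q} q≈[] i = begin
    coeff (d q) i             ≈⟨ cong-≈P q [] q≈[] i ⟩
    coeff (d (0# ·P [])) i    ≈⟨ homogeneous 0# [] i ⟩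
    coeff (0# ·P d []) i      ≈⟨ coeff-·P 0# (d []) i ⟩
    0# * coeff (d []) i       ≈⟨ zeroˡ _ ⟩
    0#                        ∎

  d-X^⋆-∷ : ∀ j b p i → coeff (d (X^ j ⋆ (b ∷ p))) i ≈ b * coeff (d (X^ j)) i + coeff (d (X^ suc j ⋆ p)) i
  d-X^⋆-∷ j b p i = begin
    coeff (d (X^ j ⋆ (b ∷ p))) i                            ≈⟨ cong-≈P _ _ (X^⋆-∷ j b p) i ⟩
    coeff (d ((b ·P X^ j) +P X^ suc j ⋆ p)) i                ≈⟨ additive (b ·P X^ j) (X^ suc j ⋆ p) i ⟩
    coeff (d (b ·P X^ j) +P d (X^ suc j ⋆ p)) i              ≈⟨ coeff-+P (d (b ·P X^ j)) (d (X^ suc j ⋆ p)) i ⟩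
    coeff (d (b ·P X^ j)) i + coeff (d (X^ suc j ⋆ p)) i     ≈⟨ +-congʳ (trans (homogeneous b (X^ j) i) (coeff-·P b (d (X^ j)) i)) ⟩
    b * coeff (d (X^ j)) i + coeff (d (X^ suc j ⋆ p)) i      ∎

  γ : ℕ → Carrier
  γ i = coeff (d (X^ i)) 0

  coeff₀-d-X^⋆ : ∀ p j → coeff (d (X^ j ⋆ p)) 0 ≈ sumTo (length p) (λ i → coeff p i * γ (j ℕ.+ i))
  coeff₀-d-X^⋆ []      j = d-≈[] (X^⋆-≈[] j (λ _ → refl)) 0
  coeff₀-d-X^⋆ (b ∷ p) j = trans (d-X^⋆-∷ j b p 0) (+-cong
    (*-congˡ (reflexive (≡.cong γ (≡.sym (ℕₚ.+-identityʳ j)))))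
    (trans (coeff₀-d-X^⋆ p (suc j))
           (sumTo-cong (length p) (λ i _ → *-congˡ (reflexive (≡.cong γ (≡.sym (ℕₚ.+-suc j i))))))))

  d-X^-coeff : ℕ → ℕ → Carrier
  d-X^-coeff m i = fromℕ (m C (m ∸ i)) * γ (m ∸ i)

  -- Shift invariance: (d xᵐ)(a) = (d (x + a)ᵐ)(0) = Σᵢ C(m,i) a^(m−i) γᵢ.
  eval-d-X^ : ∀ m a → eval a (d (X^ m)) ≈ eval a (fromCoeffs (suc m) (d-X^-coeff m))
  eval-d-X^ m a = begin
    eval a (d (X^ m))                                             ≈⟨ coeff₀-shift a (d (X^ m)) ⟨
    coeff (shift a (d (X^ m))) 0                                  ≈⟨ shiftInvariant a (X^ m) 0 ⟨
    coeff (d (shift a (X^ m))) 0                                  ≈⟨ coeff₀-d-X^⋆ (shift a (X^ m)) 0 ⟩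
    sumTo (length (shift a (X^ m))) (λ i → coeff (shift a (X^ m)) i * γ i)
                                                                  ≡⟨ ≡.cong (λ n → sumTo n (λ i → coeff (shift a (X^ m)) i * γ i)) length-shift-X^ ⟩
    sumTo (suc m) (λ i → coeff (shift a (X^ m)) i * γ i)          ≈⟨ sumTo-cong (suc m) {g = λ i → fromℕ (m C i) * a ^ (m ∸ i) * γ i} (λ i _ → *-congʳ (coeff-shift-X^ a m i)) ⟩
    sumTo (suc m) (λ i → fromℕ (m C i) * a ^ (m ∸ i) * γ i)       ≈⟨ sumTo-reverse m (λ i → fromℕ (m C i) * a ^ (m ∸ i) * γ i) ⟩
    sumTo (suc m) (λ i → fromℕ (m C (m ∸ i)) * a ^ (m ∸ (m ∸ i)) * γ (m ∸ i))
                                                                  ≈⟨ sumTo-cong (suc m) reindex ⟩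
    sumTo (suc m) (λ i → d-X^-coeff m i * a ^ i)                  ≈⟨ eval-fromCoeffs a (suc m) (d-X^-coeff m) ⟨
    eval a (fromCoeffs (suc m) (d-X^-coeff m))                    ∎
    where
      length-shift-X^ : length (shift a (X^ m)) ≡ suc m
      length-shift-X^ = ≡.trans (length-shift a (X^ m)) (≡.trans (length-X^⋆ m (const 1#)) (ℕₚ.+-comm m 1))

      reindex : ∀ i → i < suc m → fromℕ (m C (m ∸ i)) * a ^ (m ∸ (m ∸ i)) * γ (m ∸ i) ≈ d-X^-coeff m i * a ^ i
      reindex i (s≤s i≤m) = begin
        fromℕ (m C (m ∸ i)) * a ^ (m ∸ (m ∸ i)) * γ (m ∸ i)  ≡⟨ ≡.cong (λ e → fromℕ (m C (m ∸ i)) * a ^ e * γ (m ∸ i)) (ℕₚ.m∸[m∸n]≡n i≤m) ⟩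
        fromℕ (m C (m ∸ i)) * a ^ i * γ (m ∸ i)              ≈⟨ solve 3 (λ x y z → x :* y :* z := x :* z :* y) refl (fromℕ (m C (m ∸ i))) (a ^ i) (γ (m ∸ i)) ⟩
        d-X^-coeff m i * a ^ i                               ∎

  d-X^ : ∀ m → d (X^ m) ≈P fromCoeffs (suc m) (d-X^-coeff m)
  d-X^ m = eval-injective char0 (d (X^ m)) (fromCoeffs (suc m) (d-X^-coeff m)) (eval-d-X^ m)

  γ₀≈0 : γ 0 ≈ 0#
  γ₀≈0 = begin
    γ 0               ≈⟨ solve 1 (λ x → x := (con 1 :+ con 0) :* x) refl (γ 0) ⟩
    fromℕ 1 * γ 0     ≈⟨ d-X^ 1 1 ⟨
    coeff (d X) 1     ≈⟨ dX≈k 1 ⟩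
    0#                ∎

  γ₁≈k : γ 1 ≈ k
  γ₁≈k = dX≈k 0

  coeff-d-X^-≥ : ∀ {m i} → m ≤ i → coeff (d (X^ m)) i ≈ 0#
  coeff-d-X^-≥ {m} {i} m≤i with ℕₚ.m≤n⇒m<n∨m≡n m≤i
  ... | inj₁ m<i    = trans (d-X^ m i) (reflexive (coeff-fromCoeffs-≥ (suc m) (d-X^-coeff m) m<i))
  ... | inj₂ ≡.refl = begin
    coeff (d (X^ m)) m                        ≈⟨ d-X^ m m ⟩
    coeff (fromCoeffs (suc m) (d-X^-coeff m)) m ≡⟨ coeff-fromCoeffs-< (suc m) (d-X^-coeff m) (ℕₚ.n<1+n m) ⟩
    fromℕ (m C (m ∸ m)) * γ (m ∸ m)           ≡⟨ ≡.cong (λ e → fromℕ (m C e) * γ e) (ℕₚ.n∸n≡0 m) ⟩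
    fromℕ (m C 0) * γ 0                       ≈⟨ *-congˡ γ₀≈0 ⟩
    fromℕ (m C 0) * 0#                        ≈⟨ zeroʳ _ ⟩
    0#                                        ∎

  coeff-d-X^-pred : ∀ m → coeff (d (X^ m)) (m ∸ 1) ≈ fromℕ m * k
  coeff-d-X^-pred zero    = trans (coeff-d-X^-≥ z≤n) (sym (zeroˡ k))
  coeff-d-X^-pred (suc m) = begin
    coeff (d (X^ suc m)) m                                   ≈⟨ d-X^ (suc m) m ⟩
    coeff (fromCoeffs (suc (suc m)) (d-X^-coeff (suc m))) m  ≡⟨ coeff-fromCoeffs-< (suc (suc m)) (d-X^-coeff (suc m)) (ℕₚ.m<n⇒m<1+n (ℕₚ.n<1+n m)) ⟩
    fromℕ (suc m C (suc m ∸ m)) * γ (suc m ∸ m)              ≡⟨ ≡.cong (λ e → fromℕ (suc m C e) * γ e) (ℕₚ.m+n∸n≡m 1 m) ⟩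
    fromℕ (suc m C 1) * γ 1                                  ≡⟨ ≡.cong (λ e → fromℕ e * γ 1) (nC1≡n (suc m)) ⟩
    fromℕ (suc m) * γ 1                                      ≈⟨ *-congˡ γ₁≈k ⟩
    fromℕ (suc m) * k                                        ∎

  d-X^⋆-degree : ∀ p j N → j ≤ N → (∀ i → N < i ℕ.+ j → coeff p i ≈ 0#) →
                 (∀ i → N ≤ i → coeff (d (X^ j ⋆ p)) i ≈ 0#)
                 × coeff (d (X^ j ⋆ p)) (N ∸ 1) ≈ fromℕ N * k * coeff p (N ∸ j)
  d-X^⋆-degree []      j N _ _ = (λ i _ → d-≈[] dX^⋆[]≈[] i) , trans (d-≈[] dX^⋆[]≈[] _) (sym (zeroʳ _))
    where dX^⋆[]≈[] = X^⋆-≈[] j {[]} (λ _ → refl)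
  d-X^⋆-degree (b ∷ p) j N j≤N p≤N with ℕₚ.m≤n⇒m<n∨m≡n j≤N
  ... | inj₂ ≡.refl = vanishes , leading
    where
      rest≈[] : d (X^ suc j ⋆ p) ≈P []
      rest≈[] = d-≈[] (X^⋆-≈[] (suc j) (λ i → p≤N (suc i) (s≤s (ℕₚ.m≤n+m j i))))
      only-b : ∀ i → coeff (d (X^ j ⋆ (b ∷ p))) i ≈ b * coeff (d (X^ j)) i
      only-b i = trans (d-X^⋆-∷ j b p i) (trans (+-congˡ (rest≈[] i)) (+-identityʳ _))
      vanishes : ∀ i → j ≤ i → coeff (d (X^ j ⋆ (b ∷ p))) i ≈ 0#
      vanishes i j≤i = trans (only-b i) (trans (*-congˡ (coeff-d-X^-≥ j≤i)) (zeroʳ b))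
      leading : coeff (d (X^ j ⋆ (b ∷ p))) (j ∸ 1) ≈ fromℕ j * k * coeff (b ∷ p) (j ∸ j)
      leading = begin
        coeff (d (X^ j ⋆ (b ∷ p))) (j ∸ 1)       ≈⟨ only-b (j ∸ 1) ⟩
        b * coeff (d (X^ j)) (j ∸ 1)             ≈⟨ *-congˡ (coeff-d-X^-pred j) ⟩
        b * (fromℕ j * k)                        ≈⟨ *-comm _ _ ⟩
        fromℕ j * k * b                          ≡⟨ ≡.cong (λ e → fromℕ j * k * coeff (b ∷ p) e) (ℕₚ.n∸n≡0 j) ⟨
        fromℕ j * k * coeff (b ∷ p) (j ∸ j)      ∎
  ... | inj₁ j<N = vanishes , leading
    where
      IH = d-X^⋆-degree p (suc j) N j<N (λ i N<i+1+j → p≤N (suc i) (≡.subst (N <_) (ℕₚ.+-suc i j) N<i+1+j))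
      b-term≈0 : ∀ {i} → j ≤ i → b * coeff (d (X^ j)) i ≈ 0#
      b-term≈0 j≤i = trans (*-congˡ (coeff-d-X^-≥ j≤i)) (zeroʳ b)
      vanishes : ∀ i → N ≤ i → coeff (d (X^ j ⋆ (b ∷ p))) i ≈ 0#
      vanishes i N≤i = trans (d-X^⋆-∷ j b p i) (trans (+-cong (b-term≈0 (ℕₚ.≤-trans j≤N N≤i)) (proj₁ IH i N≤i)) (+-identityʳ _))
      leading : coeff (d (X^ j ⋆ (b ∷ p))) (N ∸ 1) ≈ fromℕ N * k * coeff (b ∷ p) (N ∸ j)
      leading = begin
        coeff (d (X^ j ⋆ (b ∷ p))) (N ∸ 1)                              ≈⟨ d-X^⋆-∷ j b p (N ∸ 1) ⟩
        b * coeff (d (X^ j)) (N ∸ 1) + coeff (d (X^ suc j ⋆ p)) (N ∸ 1)  ≈⟨ +-cong (b-term≈0 (ℕₚ.∸-monoˡ-≤ 1 j<N)) (proj₂ IH) ⟩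
        0# + fromℕ N * k * coeff p (N ∸ suc j)                          ≈⟨ +-identityˡ _ ⟩
        fromℕ N * k * coeff p (N ∸ suc j)                               ≡⟨ ≡.cong (λ e → fromℕ N * k * coeff (b ∷ p) e) (ℕₚ.+-∸-assoc 1 j<N) ⟨
        fromℕ N * k * coeff (b ∷ p) (N ∸ j)                             ∎

  module _ {p N} (p≤N : DegreeAtMost p N) where
    private
      degree-hyp : ∀ i → N < i ℕ.+ 0 → coeff p i ≈ 0#
      degree-hyp i N<i+0 = p≤N i (≡.subst (N <_) (ℕₚ.+-identityʳ i) N<i+0)

    d-lowers-degree : ∀ i → N ≤ i → coeff (d p) i ≈ 0#
    d-lowers-degree = proj₁ (d-X^⋆-degree p 0 N z≤n degree-hyp)

    d-leading-coeff : coeff (d p) (N ∸ 1) ≈ fromℕ N * k * coeff p N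
    d-leading-coeff = proj₂ (d-X^⋆-degree p 0 N z≤n degree-hyp)

  iter-lowers-degree : ∀ {p N} j → j ≤ N → DegreeAtMost p N → DegreeAtMost (iter d j p) (N ∸ j)
  iter-lowers-degree zero    _   p≤N = p≤N
  iter-lowers-degree (suc j) j<N p≤N i N∸1+j<i =
    d-lowers-degree (iter-lowers-degree j (ℕₚ.<⇒≤ j<N) p≤N) i (≡.subst (_≤ i) (≡.sym (ℕₚ.+-∸-assoc 1 j<N)) N∸1+j<i)

  iter-leading-coeff : ∀ {p N} j → j ≤ N → DegreeAtMost p N →
                       coeff (iter d j p) (N ∸ j) ≈ fromℕ (fall N j) * k ^ j * coeff p N
  iter-leading-coeff {p} {N} zero    _   p≤N = solve 1 (λ x → x := (con 1 :+ con 0) :* con 1 :* x) refl (coeff p N)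
  iter-leading-coeff {p} {N} (suc j) j<N p≤N = begin
    coeff (d q) (N ∸ suc j)                             ≡⟨ ≡.cong (λ e → coeff (d q) (e ∸ 1)) (ℕₚ.+-∸-assoc 1 j<N) ⟨
    coeff (d q) ((N ∸ j) ∸ 1)                           ≈⟨ d-leading-coeff (iter-lowers-degree j j≤N p≤N) ⟩
    fromℕ (N ∸ j) * k * coeff q (N ∸ j)                 ≈⟨ *-congˡ (iter-leading-coeff j j≤N p≤N) ⟩
    fromℕ (N ∸ j) * k * (fromℕ (fall N j) * k ^ j * coeff p N)
                                                        ≈⟨ solve 5 (λ a b c e f → a :* b :* (c :* e :* f) := a :* c :* (b :* e) :* f) refl
                                                                   (fromℕ (N ∸ j)) k (fromℕ (fall N j)) (k ^ j) (coeff p N) ⟩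
    fromℕ (N ∸ j) * fromℕ (fall N j) * k ^ suc j * coeff p N
                                                        ≈⟨ *-congʳ (*-congʳ (fromℕ-* (N ∸ j) (fall N j))) ⟨
    fromℕ (fall N (suc j)) * k ^ suc j * coeff p N      ∎
    where
      q = iter d j p
      j≤N = ℕₚ.<⇒≤ j<N

  iter-annihilates : ∀ {p N} j → N < j → DegreeAtMost p N → iter d j p ≈P []
  iter-annihilates {p} {N} (suc j) (s≤s N≤j) p≤N with ℕₚ.m≤n⇒m<n∨m≡n N≤j
  ... | inj₁ N<j    = d-≈[] (iter-annihilates j N<j p≤N)
  ... | inj₂ ≡.refl = λ i → d-lowers-degree {N = 0} q≤0 i z≤n
    where
      q≤0 : DegreeAtMost (iter d N p) 0
      q≤0 = ≡.subst (DegreeAtMost (iter d N p)) (ℕₚ.n∸n≡0 N) (iter-lowers-degree N ℕₚ.≤-refl p≤N)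

  iter-homogeneous : ∀ i u p → iter d i (u ·P p) ≈P (u ·P iter d i p)
  iter-homogeneous zero    u p _ = refl
  iter-homogeneous (suc i) u p n =
    trans (cong-≈P (iter d i (u ·P p)) (u ·P iter d i p) (iter-homogeneous i u p) n) (homogeneous u (iter d i p) n)

module DerivedBasis {c ℓ : Level} (F : Field c ℓ) (char0 : PolyOver.CharZero F)
  (d : PolyOver.Poly F → PolyOver.Poly F) (δ : PolyOver.IsDeltaOperator F d)
  (z : ℕ → Field.Carrier F) (t : ℕ → PolyOver.Poly F) (basis : PolyOver.IsGoncarovBasis F d z t) where
  open Field F
  open PolyOver F
  open FieldProperties F
  open PolyProperties F
  open DeltaOperatorProperties F char0 d δ
  open IsGoncarovBasis basis
  open import Algebra.Solver.Ring.NaturalCoefficients.Default commutativeSemiring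
  open import Relation.Binary.Reasoning.Setoid setoid

  fromℕ-fall-≉0 : ∀ n j → fromℕ (fall (n ℕ.+ j) j) ≉ 0#
  fromℕ-fall-≉0 n j = fromℕ-≉0 char0 (fall≢0 (ℕₚ.m≤n+m j n))

  module _ (j n : ℕ) where
    private
      L = n ℕ.+ j
      Fc = fromℕ (fall L j)
      Fc⁻¹ = Fc ⁻¹
      T = iter d j (t L)
      L∸j≡n : L ∸ j ≡ n
      L∸j≡n = ℕₚ.m+n∸n≡m n j
      j≤L : j ≤ L
      j≤L = ℕₚ.m≤n+m j n

    derivedBasis-degree : HasDegree (derivedBasis d t j n) n
    derivedBasis-degree = leading≉0 , vanishes
      where
        coeff-derived : ∀ i → coeff (derivedBasis d t j n) i ≈ Fc⁻¹ * coeff T i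
        coeff-derived = coeff-·P Fc⁻¹ T
        T≤n : DegreeAtMost T n
        T≤n = ≡.subst (DegreeAtMost T) L∸j≡n (iter-lowers-degree j j≤L (proj₂ (degree L)))
        T-leading : coeff T n ≈ Fc * k ^ j * coeff (t L) L
        T-leading = ≡.subst (λ e → coeff T e ≈ Fc * k ^ j * coeff (t L) L) L∸j≡n (iter-leading-coeff j j≤L (proj₂ (degree L)))
        leading≉0 : coeff (derivedBasis d t j n) n ≉ 0#
        leading≉0 leading≈0 =
          *-≉0 (⁻¹-≉0 (fromℕ-fall-≉0 n j)) (*-≉0 (*-≉0 (fromℕ-fall-≉0 n j) (^-≉0 k≉0 j)) (proj₁ (degree L)))
               (trans (*-congˡ (sym T-leading)) (trans (sym (coeff-derived n)) leading≈0))
        vanishes : ∀ m → n < m → coeff (derivedBasis d t j n) m ≈ 0#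
        vanishes m n<m = trans (coeff-derived m) (trans (*-congˡ (T≤n m n<m)) (zeroʳ _))

    derivedBasis-interp : ∀ i → eval (shiftGrid z j i) (iter d i (derivedBasis d t j n)) ≈ fromℕ (n !) * kdelta i n
    derivedBasis-interp i = begin
      eval w (iter d i (Fc⁻¹ ·P T))                   ≈⟨ eval-cong w (iter d i (Fc⁻¹ ·P T)) (Fc⁻¹ ·P iter d i T) (iter-homogeneous i Fc⁻¹ T) ⟩
      eval w (Fc⁻¹ ·P iter d i T)                     ≈⟨ eval-·P w Fc⁻¹ (iter d i T) ⟩
      Fc⁻¹ * eval w (iter d i T)                      ≡⟨ ≡.cong (λ q → Fc⁻¹ * eval w q) (iter-+ d i j (t L)) ⟩
      Fc⁻¹ * eval w (iter d (i ℕ.+ j) (t L))          ≈⟨ *-congˡ (interp (i ℕ.+ j) L) ⟩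
      Fc⁻¹ * (fromℕ (L !) * kdelta (i ℕ.+ j) L)       ≡⟨ ≡.cong (λ e → Fc⁻¹ * (fromℕ (L !) * e)) (kdelta-+ i n j) ⟩
      Fc⁻¹ * (fromℕ (L !) * kdelta i n)               ≈⟨ *-congˡ (*-congʳ L!≈Fc*n!) ⟩
      Fc⁻¹ * (Fc * fromℕ (n !) * kdelta i n)          ≈⟨ solve 4 (λ a b x y → a :* (b :* x :* y) := (b :* a) :* (x :* y)) refl Fc⁻¹ Fc (fromℕ (n !)) (kdelta i n) ⟩
      (Fc * Fc⁻¹) * (fromℕ (n !) * kdelta i n)        ≈⟨ *-congʳ (inverseʳ Fc (fromℕ-fall-≉0 n j)) ⟩
      1# * (fromℕ (n !) * kdelta i n)                  ≈⟨ *-identityˡ _ ⟩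
      fromℕ (n !) * kdelta i n                         ∎
      where
        w = z (i ℕ.+ j)
        L!≈Fc*n! : fromℕ (L !) ≈ Fc * fromℕ (n !)
        L!≈Fc*n! = begin
          fromℕ (L !)                         ≡⟨ ≡.cong fromℕ (fall-*-! L j j≤L) ⟨
          fromℕ (fall L j ℕ.* (L ∸ j) !)      ≡⟨ ≡.cong (λ e → fromℕ (fall L j ℕ.* e !)) L∸j≡n ⟩
          fromℕ (fall L j ℕ.* n !)            ≈⟨ fromℕ-* (fall L j) (n !) ⟩
          Fc * fromℕ (n !)                    ∎

  derivedBasis-isGoncarov : ∀ j → IsGoncarovBasis d (shiftGrid z j) (derivedBasis d t j)
  derivedBasis-isGoncarov j = record
    { degree = derivedBasis-degree j
    ; interp = λ i n → derivedBasis-interp j n i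
    }

  iter-basis : ∀ j n → iter d j (t n) ≈P (fromℕ (fall n j) ·P derivedBasis d t j (n ∸ j))
  iter-basis j n with ℕₚ.≤-<-connex j n
  ... | inj₁ j≤n = rescale (n ∸ j) (ℕₚ.m∸n+n≡m j≤n)
    where
      rescale : ∀ m {n} → m ℕ.+ j ≡ n → iter d j (t n) ≈P (fromℕ (fall n j) ·P derivedBasis d t j m)
      rescale m ≡.refl = ·P-inverse (fromℕ-fall-≉0 m j) (iter d j (t (m ℕ.+ j)))
  ... | inj₂ n<j = λ i → begin
    coeff (iter d j (t n)) i                  ≈⟨ iter-annihilates j n<j (proj₂ (degree n)) i ⟩
    0#                                        ≈⟨ zeroˡ _ ⟨
    fromℕ 0 * coeff t′ i                      ≡⟨ ≡.cong (λ e → fromℕ e * coeff t′ i) (fall≡0 n<j) ⟨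
    fromℕ (fall n j) * coeff t′ i             ≈⟨ coeff-·P (fromℕ (fall n j)) t′ i ⟨
    coeff (fromℕ (fall n j) ·P t′) i          ∎
    where t′ = derivedBasis d t j (n ∸ j)

proposition3p2 : ∀ {c ℓ : Level} (F : Field c ℓ) →
    let open Field F
        open PolyOver F
    in CharZero →
       (d : Poly → Poly) → IsDeltaOperator d →
       (z : ℕ → Carrier) → (t : ℕ → Poly) → IsGoncarovBasis d z t →
       (j : ℕ) →
       IsGoncarovBasis d (shiftGrid z j) (derivedBasis d t j)
       × (∀ n → iter d j (t n) ≈P (fromℕ (fall n j) ·P derivedBasis d t j (n ∸ j)))
proposition3p2 F char0 d δ z t basis j = derivedBasis-isGoncarov j , iter-basis j
  where open DerivedBasis F char0 d δ z t basis
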